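{- Let $D$ be a digraph and let $m\geq 4$, $r,s\geq 1$ be integers with $r+s=m-2$. Let $T_1=ODS(m;r,s)$, $T_2=IDS(m;r,s)$, $T_3=OIDS(m;r,s)$ (defined in the context). (i) If there is an arc $(u,v)\in A(D)$ such that $|N_D^+(u)\setminus\{v\}|\geq m-3$, $|N_D^+(v)\setminus\{u\}|\geq m-3$ and $|(N_D^+(u)\cup N_D^+(v))\setminus\{u,v\}|\geq m-2$, then $D$ contains a subdigraph isomorphic to $T_1$. (ii) If there is an arc $(u,v)\in A(D)$ such that $|N_D^-(u)\setminus\{v\}|\geq m-3$, $|N_D^-(v)\setminus\{u\}|\geq m-3$ and $|(N_D^-(u)\cup N_D^-(v))\setminus\{u,v\}|\geq m-2$, then $D$ contains a subdigraph isomorphic to $T_2$. (iii) If there is an arc $(u,v)\in A(D)$ such that $|N_D^+(u)\setminus\{v\}|\geq m-3$, $|N_D^-(v)\setminus\{u\}|\geq m-3$ and $|(N_D^+(u)\cup N_D^-(v))\setminus\{u,v\}|\geq m-2$, then $D$ contains a subdigraph isomorphic to $T_3$.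
   Context: Digraphs are finite, without loops and without parallel arcs. $N_D^+(x)=\{y\neq x:(x,y)\in A(D)\}$ and $N_D^-(x)=\{y\neq x:(y,x)\in A(D)\}$. For positive integers $r,s$ with $r+s=m-2$: the out-double-star $ODS(m;r,s)$ has vertices $u,v,a_1,\dots,a_r,b_1,\dots,b_s$ (all distinct) and arcs $(u,v)$, $(u,a_i)$ for all $i$, $(v,b_j)$ for all $j$. The in-double-star $IDS(m;r,s)$ has the same vertices and arcs $(u,v)$, $(a_i,u)$, $(b_j,v)$. The out-in-double-star $OIDS(m;r,s)$ has the same vertices and arcs $(u,v)$, $(u,a_i)$, $(b_j,v)$. Each has order $m$, and $(u,v)$ is called the center-arc. -}

module Defs where

open import Data.Nat using (ℕ; zero; suc; _+_; _<ᵇ_)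
open import Data.Bool using (Bool; true; false; _∧_; _∨_; not)
open import Data.Fin using (Fin; toℕ; _≟_)
open import Data.Fin.Subset using (Subset; _∪_; _-_; ⁅_⁆; ∁; _∩_)
open import Data.Vec using (tabulate)
open import Data.Product using (Σ; _×_)
open import Function.Definitions using (Injective)
open import Relation.Nullary.Decidable using (⌊_⌋)
open import Relation.Binary.PropositionalEquality using (_≡_)

-- A (finite) digraph on vertex set Fin n: arc relation given as a Boolean
-- function; no loops; parallel arcs impossible by construction.
record Digraph : Set where
  field
    n        : ℕ
    arc      : Fin n → Fin n → Bool
    loopless : ∀ x → arc x x ≡ false
open Digraph public

outN : (D : Digraph) → Fin (n D) → Subset (n D)
outN D x = tabulate λ y → arc D x y ∧ not ⌊ x ≟ y ⌋

inN : (D : Digraph) → Fin (n D) → Subset (n D)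
inN D x = tabulate λ y → arc D y x ∧ not ⌊ x ≟ y ⌋

remove2 : {k : ℕ} → Subset k → Fin k → Fin k → Subset k
remove2 S u v = (S - u) - v

-- D contains a subdigraph isomorphic to T: an injective vertex map
-- sending every arc of T to an arc of D.
Contains : Digraph → Digraph → Set
Contains D T = Σ (Fin (n T) → Fin (n D)) λ f →
  Injective _≡_ _≡_ f × (∀ x y → arc T x y ≡ true → arc D (f x) (f y) ≡ true)

-- Vertex roles in the double stars on Fin (2 + r + s):
-- 0 = u, 1 = v, 2..r+1 = a_1..a_r, r+2..r+s+1 = b_1..b_s.
data Role : Set where
  U V A B : Role

role : (r s : ℕ) → Fin (2 + r + s) → Role
role r s x with toℕ x
... | 0 = U
... | 1 = V
... | suc (suc k) = if' (k <ᵇ r)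
  where
  if' : Bool → Role
  if' true  = A
  if' false = B

isU isV isA isB : Role → Bool
isU U = true
isU _ = false
isV V = true
isV _ = false
isA A = true
isA _ = false
isB B = true
isB _ = false

-- ODS(m; r, s) with m = 2 + r + s: arcs (u,v), (u,a_i), (v,b_j)
ODS : (r s : ℕ) → Digraph
ODS r s = record { n = 2 + r + s ; arc = ar ; loopless = ll }
  where
  ar : Fin (2 + r + s) → Fin (2 + r + s) → Bool
  ar x y = (isU (role r s x) ∧ isV (role r s y))
         ∨ (isU (role r s x) ∧ isA (role r s y))
         ∨ (isV (role r s x) ∧ isB (role r s y))
  ll : ∀ x → ar x x ≡ false
  ll x with role r s x
  ... | U = _≡_.refl
  ... | V = _≡_.refl
  ... | A = _≡_.refl
  ... | B = _≡_.refl

IDS : (r s : ℕ) → Digraph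
IDS r s = record { n = 2 + r + s ; arc = ar ; loopless = ll }
  where
  ar : Fin (2 + r + s) → Fin (2 + r + s) → Bool
  ar x y = (isU (role r s x) ∧ isV (role r s y))
         ∨ (isA (role r s x) ∧ isU (role r s y))
         ∨ (isB (role r s x) ∧ isV (role r s y))
  ll : ∀ x → ar x x ≡ false
  ll x with role r s x
  ... | U = _≡_.refl
  ... | V = _≡_.refl
  ... | A = _≡_.refl
  ... | B = _≡_.refl

OIDS : (r s : ℕ) → Digraph
OIDS r s = record { n = 2 + r + s ; arc = ar ; loopless = ll }
  where
  ar : Fin (2 + r + s) → Fin (2 + r + s) → Bool
  ar x y = (isU (role r s x) ∧ isV (role r s y))
         ∨ (isU (role r s x) ∧ isA (role r s y))
         ∨ (isB (role r s x) ∧ isV (role r s y))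
  ll : ∀ x → ar x x ≡ false
  ll x with role r s x
  ... | U = _≡_.refl
  ... | V = _≡_.refl
  ... | A = _≡_.refl
  ... | B = _≡_.refl

module Submission where

-- The three parts share one argument.  Write P for the neighbourhood of u
-- that must host the leaves a_1..a_r and Q for the neighbourhood of v that
-- must host b_1..b_s (out- or in-neighbourhoods according to the shape).
--   1. Two-set selection (a Hall-type fact for two sets): if r ≤ |X|,
--      s ≤ |Y| and r + s ≤ |X ∪ Y|, then there are r + s distinct vertices,
--      the first r in X and the remaining s in Y.  Proved by induction on r,
--      choosing a pivot a ∈ X outside Y when possible, so that Y loses at
--      most what the union bound allows.
--   2. Applied to X = P ∖ {u,v} and Y = Q ∖ {u,v}, the degree hypotheses
--      of the lemma are exactly the hypotheses of the selection.
--   3. The vertex map u ↦ u, v ↦ v, leaves ↦ selected vertices is injective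
--      and sends each vertex of the star to a vertex of the matching "role";
--      every arc of the star is then an arc of D because of how P and Q
--      were defined.

open import Defs
open import Data.Nat using (ℕ; _+_; _∸_; _≤_; _≥_)
open import Data.Bool using (true)
open import Data.Fin using (Fin)
open import Data.Fin.Subset using (_∪_; _-_; ∣_∣)
open import Data.Product using (_×_)
open import Relation.Binary.PropositionalEquality using (_≡_)

open import Data.Nat using (zero; suc; _<_; _<ᵇ_; s≤s)
open import Data.Nat.Properties
  using (≤-trans; ≤-reflexive; ≤-pred; ≮⇒≥; _<?_; m≤n⇒m≤1+n; +-suc; +-comm;
         m+n≤o⇒m≤o; m+n≤o⇒n≤o; <ᵇ-reflects-<)
open import Data.Bool using (Bool; false; _∧_; _∨_; not)
open import Data.Empty using (⊥-elim)
open import Data.Fin using (zero; suc; toℕ; _≟_)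
open import Data.Fin.Subset using (Subset; _─_; _∈_; _∉_; _⊆_; ⁅_⁆; Nonempty; inside; outside)
open import Data.Fin.Subset.Properties
  using (nonempty?; _∈?_; drop-there; x∈⁅x⁆; x∈p∧x∉q⇒x∈p─q; p─q⊆p; x∈p∧x≢y⇒x∈p-y; x∈p∪q⁻; x∈p∪q⁺; p⊆q⇒∣p∣≤∣q∣)
open import Data.Vec using (_∷_; tail; tabulate)
open import Data.Vec.Properties using (lookup∘tabulate; []=⇒lookup)
open import Data.Vec.Base using (here; there)
open import Data.Vec.Functional using () renaming (_∷_ to _◂_)
open import Data.Product using (Σ; _,_; proj₁; proj₂)
open import Data.Sum using (_⊎_; inj₁; inj₂)
open import Function.Definitions using (Injective)
open import Relation.Nullary using (yes; no)
open import Relation.Nullary.Decidable using (⌊_⌋)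
open import Relation.Nullary.Reflects using (ofʸ; ofⁿ)
open import Relation.Binary.PropositionalEquality using (_≢_; refl; sym; trans; cong)

private
  variable
    k : ℕ

∈─⇒∉ : {x : Fin k} (p q : Subset k) → x ∈ p ─ q → x ∉ q
∈─⇒∉ {x = zero}  (_ ∷ p) (inside  ∷ q) () here
∈─⇒∉ {x = zero}  (_ ∷ p) (outside ∷ q) _  ()
∈─⇒∉ {x = suc x} (_ ∷ p) (_ ∷ q) (there x∈) (there x∈q) = ∈─⇒∉ p q x∈ x∈q

∈-⁻ : {x y : Fin k} (p : Subset k) → x ∈ p - y → x ∈ p × x ≢ y
∈-⁻ {y = y} p x∈ = p─q⊆p p ⁅ y ⁆ x∈ , λ { refl → ∈─⇒∉ p ⁅ y ⁆ x∈ (x∈⁅x⁆ y) }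

∈remove2⁻ : {x u v : Fin k} (S : Subset k) → x ∈ remove2 S u v → x ∈ S × x ≢ u × x ≢ v
∈remove2⁻ S x∈ with ∈-⁻ (S - _) x∈
... | x∈S-u , x≢v = proj₁ (∈-⁻ S x∈S-u) , proj₂ (∈-⁻ S x∈S-u) , x≢v

∈remove2⁺ : {x u v : Fin k} {S : Subset k} → x ∈ S → x ≢ u → x ≢ v → x ∈ remove2 S u v
∈remove2⁺ x∈S x≢u x≢v = x∈p∧x≢y⇒x∈p-y (x∈p∧x≢y⇒x∈p-y x∈S x≢u) x≢v

tail-kept : (b : Bool) (p : Subset k) → p ⊆ tail ((b ∷ p) - zero)
tail-kept b p y∈p = drop-there (x∈p∧x≢y⇒x∈p-y {p = b ∷ p} {y = zero} (there y∈p) λ ())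

∣p∣≤1+∣p-x∣ : (p : Subset k) (x : Fin k) → ∣ p ∣ ≤ suc ∣ p - x ∣
∣p∣≤1+∣p-x∣ (inside  ∷ p) zero    = s≤s (p⊆q⇒∣p∣≤∣q∣ (tail-kept inside p))
∣p∣≤1+∣p-x∣ (outside ∷ p) zero    = m≤n⇒m≤1+n (p⊆q⇒∣p∣≤∣q∣ (tail-kept outside p))
∣p∣≤1+∣p-x∣ (inside  ∷ p) (suc x) = s≤s (∣p∣≤1+∣p-x∣ p x)
∣p∣≤1+∣p-x∣ (outside ∷ p) (suc x) = ∣p∣≤1+∣p-x∣ p x

shrink : {j : ℕ} (p : Subset k) (x : Fin k) → suc j ≤ ∣ p ∣ → j ≤ ∣ p - x ∣
shrink p x h = ≤-pred (≤-trans h (∣p∣≤1+∣p-x∣ p x))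

nonempty-of-size : {j : ℕ} (p : Subset k) → suc j ≤ ∣ p ∣ → Nonempty p
nonempty-of-size (inside  ∷ p) _ = zero , here
nonempty-of-size (outside ∷ p) h with nonempty-of-size p h
... | x , x∈p = suc x , there x∈p

∪-⊆ : (X Y : Subset k) (a : Fin k) → (X ∪ Y) - a ⊆ (X - a) ∪ (Y - a)
∪-⊆ X Y a x∈ with ∈-⁻ (X ∪ Y) x∈
... | x∈X∪Y , x≢a with x∈p∪q⁻ X Y x∈X∪Y
... | inj₁ x∈X = x∈p∪q⁺ (inj₁ (x∈p∧x≢y⇒x∈p-y x∈X x≢a))
... | inj₂ x∈Y = x∈p∪q⁺ (inj₂ (x∈p∧x≢y⇒x∈p-y x∈Y x≢a))

◂-injective : {n : ℕ} (a : Fin n) (g : Fin k → Fin n) → (∀ i → g i ≢ a) →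
  Injective _≡_ _≡_ g → Injective _≡_ _≡_ (a ◂ g)
◂-injective a g g≢a inj {zero}  {zero}  _ = refl
◂-injective a g g≢a inj {zero}  {suc j} e = ⊥-elim (g≢a j (sym e))
◂-injective a g g≢a inj {suc i} {zero}  e = ⊥-elim (g≢a i e)
◂-injective a g g≢a inj {suc i} {suc j} e = cong suc (inj e)

record Distinct {n : ℕ} (s : ℕ) (Y : Subset n) : Set where
  field
    elem      : Fin s → Fin n
    injective : Injective _≡_ _≡_ elem
    elem∈Y    : ∀ i → elem i ∈ Y

distinct : {n : ℕ} (s : ℕ) (Y : Subset n) → s ≤ ∣ Y ∣ → Distinct s Y
distinct zero    Y _ = record { elem = λ () ; injective = λ { {()} } ; elem∈Y = λ () }
distinct (suc s) Y h with nonempty-of-size Y h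
... | a , a∈Y = record
  { elem      = a ◂ elem
  ; injective = ◂-injective a elem (λ i → proj₂ (∈-⁻ Y (elem∈Y i))) injective
  ; elem∈Y    = λ { zero → a∈Y ; (suc i) → proj₁ (∈-⁻ Y (elem∈Y i)) }
  }
  where open Distinct (distinct s (Y - a) (shrink Y a h))

record Selection {n : ℕ} (r s : ℕ) (X Y : Subset n) : Set where
  field
    pick      : Fin (r + s) → Fin n
    injective : Injective _≡_ _≡_ pick
    first∈X   : ∀ i → toℕ i < r → pick i ∈ X
    rest∈Y    : ∀ i → r ≤ toℕ i → pick i ∈ Y

  pick∈ : ∀ i → pick i ∈ X ⊎ pick i ∈ Y
  pick∈ i with toℕ i <? r
  ... | yes i<r = inj₁ (first∈X i i<r)
  ... | no  i≮r = inj₂ (rest∈Y i (≮⇒≥ i≮r))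

cons-selection : {n r s : ℕ} {X Y : Subset n} {a : Fin n} → a ∈ X →
  Selection r s (X - a) (Y - a) → Selection (suc r) s X Y
cons-selection {X = X} {Y} {a} a∈X sel = record
  { pick      = a ◂ pick
  ; injective = ◂-injective a pick pick≢a injective
  ; first∈X   = λ { zero _ → a∈X ; (suc i) (s≤s i<r) → proj₁ (∈-⁻ X (first∈X i i<r)) }
  ; rest∈Y    = λ { zero () ; (suc i) (s≤s r≤i) → proj₁ (∈-⁻ Y (rest∈Y i r≤i)) }
  }
  where
  open Selection sel
  pick≢a : ∀ i → pick i ≢ a
  pick≢a i with pick∈ i
  ... | inj₁ ∈X-a = proj₂ (∈-⁻ X ∈X-a)
  ... | inj₂ ∈Y-a = proj₂ (∈-⁻ Y ∈Y-a)

-- The pivot of the induction step: some a ∈ X whose removal leaves Y big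
-- enough.  Take a ∈ X ∖ Y if possible; otherwise X ⊆ Y and |Y| = |X ∪ Y|.
pivot : {n r s : ℕ} (X Y : Subset n) → suc r ≤ ∣ X ∣ → s ≤ ∣ Y ∣ →
  suc r + s ≤ ∣ X ∪ Y ∣ → Σ (Fin n) λ a → a ∈ X × s ≤ ∣ Y - a ∣
pivot X Y hr hs hu with nonempty? (X ─ Y)
... | yes (a , a∈X─Y) = a , p─q⊆p X Y a∈X─Y , ≤-trans hs (p⊆q⇒∣p∣≤∣q∣ Y⊆Y-a)
  where
  Y⊆Y-a : Y ⊆ Y - a
  Y⊆Y-a y∈Y = x∈p∧x≢y⇒x∈p-y y∈Y λ { refl → ∈─⇒∉ X Y a∈X─Y y∈Y }
... | no X─Y-empty with nonempty-of-size X hr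
...   | a , a∈X = a , a∈X , m+n≤o⇒n≤o _ (shrink Y a (≤-trans hu (p⊆q⇒∣p∣≤∣q∣ X∪Y⊆Y)))
  where
  X∪Y⊆Y : X ∪ Y ⊆ Y
  X∪Y⊆Y {x} x∈ with x∈p∪q⁻ X Y x∈
  ... | inj₂ x∈Y = x∈Y
  ... | inj₁ x∈X with x ∈? Y
  ...   | yes x∈Y = x∈Y
  ...   | no  x∉Y = ⊥-elim (X─Y-empty (x , x∈p∧x∉q⇒x∈p─q x∈X x∉Y))

select : {n : ℕ} (r s : ℕ) (X Y : Subset n) →
  r ≤ ∣ X ∣ → s ≤ ∣ Y ∣ → r + s ≤ ∣ X ∪ Y ∣ → Selection r s X Y
select zero s X Y _ hs _ = record
  { pick = elem ; injective = injective ; first∈X = λ _ () ; rest∈Y = λ i _ → elem∈Y i }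
  where open Distinct (distinct s Y hs)
select (suc r) s X Y hr hs hu with pivot X Y hr hs hu
... | a , a∈X , hs' = cons-selection a∈X
  (select r s (X - a) (Y - a) (shrink X a hr) hs'
    (≤-trans (shrink (X ∪ Y) a hu) (p⊆q⇒∣p∣≤∣q∣ (∪-⊆ X Y a))))

Image : {n : ℕ} → Fin n → Fin n → Subset n → Subset n → Role → Fin n → Set
Image u v P Q U w = w ≡ u
Image u v P Q V w = w ≡ v
Image u v P Q A w = w ∈ P
Image u v P Q B w = w ∈ Q

star : {n : ℕ} → Fin n → Fin n → (Fin k → Fin n) → Fin (2 + k) → Fin n
star u v g = u ◂ (v ◂ g)

module _ {n r s : ℕ} {u v : Fin n} {P Q : Subset n}
         (sel : Selection r s (remove2 P u v) (remove2 Q u v)) where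
  open Selection sel

  pick≢ : ∀ i → pick i ≢ u × pick i ≢ v
  pick≢ i with pick∈ i
  ... | inj₁ ∈P = proj₂ (∈remove2⁻ P ∈P)
  ... | inj₂ ∈Q = proj₂ (∈remove2⁻ Q ∈Q)

  star-injective : u ≢ v → Injective _≡_ _≡_ (star u v pick)
  star-injective u≢v =
    ◂-injective u (v ◂ pick) (λ { zero → λ v≡u → u≢v (sym v≡u) ; (suc i) → proj₁ (pick≢ i) })
      (◂-injective v pick (λ i → proj₂ (pick≢ i)) injective)

  star-image : ∀ x → Image u v P Q (role r s x) (star u v pick x)
  star-image zero = refl
  star-image (suc zero) = refl
  star-image (suc (suc i)) with toℕ i <ᵇ r | <ᵇ-reflects-< (toℕ i) r
  ... | true  | ofʸ i<r = proj₁ (∈remove2⁻ P (first∈X i i<r))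
  ... | false | ofⁿ i≮r = proj₁ (∈remove2⁻ Q (rest∈Y i (≮⇒≥ i≮r)))

double-star : (D : Digraph) {r s : ℕ} (pat : Role → Role → Bool)
  (u v : Fin (n D)) (P Q : Subset (n D)) → u ≢ v →
  (∀ x → x ∈ P → x ≢ u) → (∀ x → x ∈ Q → x ≢ v) →
  r ≤ ∣ P - v ∣ → s ≤ ∣ Q - u ∣ → r + s ≤ ∣ remove2 (P ∪ Q) u v ∣ →
  (∀ ρ σ {w w′} → pat ρ σ ≡ true → Image u v P Q ρ w → Image u v P Q σ w′ → arc D w w′ ≡ true) →
  Σ (Fin (2 + r + s) → Fin (n D)) λ f → Injective _≡_ _≡_ f ×
    (∀ x y → pat (role r s x) (role r s y) ≡ true → arc D (f x) (f y) ≡ true)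
double-star D {r} {s} pat u v P Q u≢v P∌u Q∌v hr hs hu realised =
  star u v pick , star-injective sel u≢v ,
  λ x y h → realised (role r s x) (role r s y) h (star-image sel x) (star-image sel y)
  where
  P-v⊆ : P - v ⊆ remove2 P u v
  P-v⊆ {x} x∈ = ∈remove2⁺ (proj₁ (∈-⁻ P x∈)) (P∌u x (proj₁ (∈-⁻ P x∈))) (proj₂ (∈-⁻ P x∈))
  Q-u⊆ : Q - u ⊆ remove2 Q u v
  Q-u⊆ {x} x∈ = ∈remove2⁺ (proj₁ (∈-⁻ Q x∈)) (proj₂ (∈-⁻ Q x∈)) (Q∌v x (proj₁ (∈-⁻ Q x∈)))
  ∪⊆ : remove2 (P ∪ Q) u v ⊆ remove2 P u v ∪ remove2 Q u v
  ∪⊆ x∈ with ∈remove2⁻ (P ∪ Q) x∈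
  ... | x∈P∪Q , x≢u , x≢v with x∈p∪q⁻ P Q x∈P∪Q
  ... | inj₁ x∈P = x∈p∪q⁺ (inj₁ (∈remove2⁺ x∈P x≢u x≢v))
  ... | inj₂ x∈Q = x∈p∪q⁺ (inj₂ (∈remove2⁺ x∈Q x≢u x≢v))
  sel : Selection r s (remove2 P u v) (remove2 Q u v)
  sel = select r s _ _ (≤-trans hr (p⊆q⇒∣p∣≤∣q∣ P-v⊆)) (≤-trans hs (p⊆q⇒∣p∣≤∣q∣ Q-u⊆))
          (≤-trans hu (p⊆q⇒∣p∣≤∣q∣ ∪⊆))
  open Selection sel using (pick)

∈-adjacency : (b : Fin k → Bool) (z x : Fin k) →
  x ∈ tabulate (λ y → b y ∧ not ⌊ z ≟ y ⌋) → b x ≡ true × x ≢ z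
∈-adjacency b z x x∈ with b x | z ≟ x | trans (sym (lookup∘tabulate _ x)) ([]=⇒lookup x∈)
... | true  | no z≢x | _  = refl , λ x≡z → z≢x (sym x≡z)
... | true  | yes _   | ()
... | false | _       | ()

out-arc : (D : Digraph) {u x : Fin (n D)} → x ∈ outN D u → arc D u x ≡ true
out-arc D {u} {x} x∈ = proj₁ (∈-adjacency (arc D u) u x x∈)

out-irrefl : (D : Digraph) {u : Fin (n D)} → ∀ x → x ∈ outN D u → x ≢ u
out-irrefl D {u} x x∈ = proj₂ (∈-adjacency (arc D u) u x x∈)

in-arc : (D : Digraph) {u x : Fin (n D)} → x ∈ inN D u → arc D x u ≡ true
in-arc D {u} {x} x∈ = proj₁ (∈-adjacency (λ y → arc D y u) u x x∈)

in-irrefl : (D : Digraph) {u : Fin (n D)} → ∀ x → x ∈ inN D u → x ≢ u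
in-irrefl D {u} x x∈ = proj₂ (∈-adjacency (λ y → arc D y u) u x x∈)

arc⇒≢ : (D : Digraph) {u v : Fin (n D)} → arc D u v ≡ true → u ≢ v
arc⇒≢ D {u} uv refl with trans (sym uv) (loopless D u)
... | ()

-- Arc relations of ODS, IDS and OIDS in terms of vertex roles; by
-- definition, arc (ODS r s) x y is odsArc (role r s x) (role r s y), etc.
odsArc idsArc oidsArc : Role → Role → Bool
odsArc  ρ σ = (isU ρ ∧ isV σ) ∨ (isU ρ ∧ isA σ) ∨ (isV ρ ∧ isB σ)
idsArc  ρ σ = (isU ρ ∧ isV σ) ∨ (isA ρ ∧ isU σ) ∨ (isB ρ ∧ isV σ)
oidsArc ρ σ = (isU ρ ∧ isV σ) ∨ (isU ρ ∧ isA σ) ∨ (isB ρ ∧ isV σ)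

module _ (D : Digraph) {u v : Fin (n D)} (uv : arc D u v ≡ true) where

  ods-realised : ∀ ρ σ {w w′} → odsArc ρ σ ≡ true →
    Image u v (outN D u) (outN D v) ρ w → Image u v (outN D u) (outN D v) σ w′ →
    arc D w w′ ≡ true
  ods-realised U V _ refl refl = uv
  ods-realised U A _ refl w′∈  = out-arc D w′∈
  ods-realised V B _ refl w′∈  = out-arc D w′∈
  ods-realised U U ()
  ods-realised U B ()
  ods-realised V U ()
  ods-realised V V ()
  ods-realised V A ()
  ods-realised A _ ()
  ods-realised B _ ()

  ids-realised : ∀ ρ σ {w w′} → idsArc ρ σ ≡ true →
    Image u v (inN D u) (inN D v) ρ w → Image u v (inN D u) (inN D v) σ w′ →
    arc D w w′ ≡ true
  ids-realised U V _ refl refl = uv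
  ids-realised A U _ w∈ refl   = in-arc D w∈
  ids-realised B V _ w∈ refl   = in-arc D w∈
  ids-realised U U ()
  ids-realised U A ()
  ids-realised U B ()
  ids-realised V _ ()
  ids-realised A V ()
  ids-realised A A ()
  ids-realised A B ()
  ids-realised B U ()
  ids-realised B A ()
  ids-realised B B ()

  oids-realised : ∀ ρ σ {w w′} → oidsArc ρ σ ≡ true →
    Image u v (outN D u) (inN D v) ρ w → Image u v (outN D u) (inN D v) σ w′ →
    arc D w w′ ≡ true
  oids-realised U V _ refl refl = uv
  oids-realised U A _ refl w′∈  = out-arc D w′∈
  oids-realised B V _ w∈ refl   = in-arc D w∈
  oids-realised U U ()
  oids-realised U B ()
  oids-realised V _ ()
  oids-realised A _ ()
  oids-realised B U ()
  oids-realised B A ()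
  oids-realised B B ()

summand-bound : ∀ a b {c} → a + suc b ≡ suc c → a ≤ c
summand-bound a b e = m+n≤o⇒m≤o a (≤-pred (≤-reflexive (trans (sym (+-suc a b)) e)))

leaf-bounds : ∀ m r s → m ≥ 4 → r ≥ 1 → s ≥ 1 → r + s ≡ m ∸ 2 →
  r ≤ m ∸ 3 × s ≤ m ∸ 3 × r + s ≤ m ∸ 2
leaf-bounds (suc (suc (suc m))) (suc r) (suc s) _ _ _ e =
  summand-bound (suc r) s e ,
  summand-bound (suc s) r (trans (+-comm (suc s) (suc r)) e) ,
  ≤-reflexive e

lemma4p3 : (D : Digraph) (m r s : ℕ) → m ≥ 4 → r ≥ 1 → s ≥ 1 → r + s ≡ m ∸ 2 →
    ((u v : Fin (n D)) → arc D u v ≡ true →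
      ∣ outN D u - v ∣ ≥ m ∸ 3 → ∣ outN D v - u ∣ ≥ m ∸ 3 →
      ∣ remove2 (outN D u ∪ outN D v) u v ∣ ≥ m ∸ 2 →
      Contains D (ODS r s))
    × ((u v : Fin (n D)) → arc D u v ≡ true →
      ∣ inN D u - v ∣ ≥ m ∸ 3 → ∣ inN D v - u ∣ ≥ m ∸ 3 →
      ∣ remove2 (inN D u ∪ inN D v) u v ∣ ≥ m ∸ 2 →
      Contains D (IDS r s))
    × ((u v : Fin (n D)) → arc D u v ≡ true →
      ∣ outN D u - v ∣ ≥ m ∸ 3 → ∣ inN D v - u ∣ ≥ m ∸ 3 →
      ∣ remove2 (outN D u ∪ inN D v) u v ∣ ≥ m ∸ 2 →
      Contains D (OIDS r s))
lemma4p3 D m r s hm hr hs e with leaf-bounds m r s hm hr hs e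
... | r≤ , s≤ , r+s≤ =
  (λ u v uv hu hv huv →
    double-star D odsArc u v (outN D u) (outN D v) (arc⇒≢ D uv)
      (out-irrefl D) (out-irrefl D) (≤-trans r≤ hu) (≤-trans s≤ hv) (≤-trans r+s≤ huv)
      (ods-realised D uv)) ,
  (λ u v uv hu hv huv →
    double-star D idsArc u v (inN D u) (inN D v) (arc⇒≢ D uv)
      (in-irrefl D) (in-irrefl D) (≤-trans r≤ hu) (≤-trans s≤ hv) (≤-trans r+s≤ huv)
      (ids-realised D uv)) ,
  (λ u v uv hu hv huv →
    double-star D oidsArc u v (outN D u) (inN D v) (arc⇒≢ D uv)
      (out-irrefl D) (in-irrefl D) (≤-trans r≤ hu) (≤-trans s≤ hv) (≤-trans r+s≤ huv)
      (oids-realised D uv))
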